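{- There is a constant $c_1>0$ such that for all sufficiently large $N$ there exists an integer $M\le \frac{N^2}{2}-c_1N\sqrt{N}$ (with $0\le M\le\binom N2$) such that no forest $F$ with $e(F)=N$ has $e(L(F))=M$; that is, the smallest such $M$ satisfies $M\le \frac{N^2}{2}-c_1N\sqrt{N}$.
   Context: All graphs are finite and simple; a forest is an acyclic graph. $L(F)$ is the line graph, so $e(L(F))=\sum_v\binom{\deg(v)}{2}$. -}

module Defs where

open import Data.Nat using (ℕ; zero; suc; _+_; _*_; _<ᵇ_; _≤_)
open import Data.Nat.Combinatorics using (_C_)
open import Data.Bool using (Bool; true; false; if_then_else_; _∧_)
open import Data.Fin using (Fin; zero; suc; toℕ)
open import Data.List using (List; []; _∷_; _++_; take; length)
open import Data.List.Relation.Unary.Unique.Propositional using (Unique)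
open import Data.Product using (_×_; ∃)
open import Data.Unit using (⊤)
open import Relation.Binary.PropositionalEquality using (_≡_)
open import Relation.Nullary using (¬_)

record Graph (n : ℕ) : Set where
  field
    adj    : Fin n → Fin n → Bool
    sym    : ∀ i j → adj i j ≡ adj j i
    irrefl : ∀ i → adj i i ≡ false
open Graph public

sumFin : ∀ {n} → (Fin n → ℕ) → ℕ
sumFin {zero}  f = 0
sumFin {suc n} f = f zero + sumFin (λ i → f (suc i))

countFin : ∀ {n} → (Fin n → Bool) → ℕ
countFin b = sumFin (λ i → if b i then 1 else 0)

degree : ∀ {n} → Graph n → Fin n → ℕ
degree G v = countFin (adj G v)

numEdges : ∀ {n} → Graph n → ℕ
numEdges G = sumFin (λ i → countFin (λ j → adj G i j ∧ (toℕ i <ᵇ toℕ j)))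

lineGraphEdges : ∀ {n} → Graph n → ℕ
lineGraphEdges G = sumFin (λ v → degree G v C 2)

IsWalk : ∀ {n} → Graph n → List (Fin n) → Set
IsWalk G []            = ⊤
IsWalk G (x ∷ [])      = ⊤
IsWalk G (x ∷ y ∷ vs)  = (adj G x y ≡ true) × IsWalk G (y ∷ vs)

IsCycle : ∀ {n} → Graph n → List (Fin n) → Set
IsCycle G vs = (3 ≤ length vs) × Unique vs × IsWalk G (vs ++ take 1 vs)

IsForest : ∀ {n} → Graph n → Set
IsForest G = ∀ vs → ¬ IsCycle G vs

Realisable : ℕ → ℕ → Set
Realisable N M = ∃ λ n → ∃ λ (F : Graph n) →
  IsForest F × (numEdges F ≡ N) × (lineGraphEdges F ≡ M)

{-# OPTIONS --safe #-}
-- Take K with 16K² ≤ N < 16(K+1)², put n = N − K and M = C(n,2) + K² + K + 1.  If a graph with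
-- N edges and maximum degree Δ had Σ_v C(d_v,2) = M, then 2M = Σ_v d_v (d_v − 1) would satisfy
--   Δ(Δ − 1) ≤ 2M,   2M ≤ (Δ − 1) 2N,   2M ≤ Δ(Δ − 1) + 2(N + 1 − Δ)(N − Δ),
-- the last because d_u + d_v ≤ N + 1 for distinct u, v.  The first fails for Δ > n, the third for
-- 3Δ > N + 3K + 2 and the second for the remaining Δ.  Finally
-- N² − 2M ≥ 2KN ≥ N^(3/2)/4, which gives c₁ = 1/8.
module Submission where

open import Defs hiding (sym)
open import Data.Nat using (ℕ; zero; suc; _+_; _*_; _∸_; _^_; _≤_; _<_; _<ᵇ_; z≤n; s≤s; z<s; NonZero; >-nonZero⁻¹)
open import Data.Nat.Properties hiding (_≟_)
open import Data.Nat.Combinatorics using (_C_; nC1≡n; nCk+nC[k+1]≡[n+1]C[k+1])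
open import Data.Nat.Tactic.RingSolver using (solve-∀)
open import Data.Bool using (true; false; if_then_else_; _∧_; T)
open import Data.Unit using (tt)
open import Data.Fin using (Fin; zero; suc; toℕ)
open import Data.Fin.Properties using (_≟_; toℕ-injective)
open import Data.Product using (∃; _,_; _×_; proj₁; proj₂)
open import Data.List using (allFin)
import Data.List.Relation.Unary.All as All
open import Data.List.Membership.Propositional.Properties using (∈-allFin)
open import Data.List.Extrema.Nat using (argmax; f[xs]≤f[argmax])
open import Data.Sum using (inj₁; inj₂)
open import Function using (_∘_)
open import Relation.Binary.PropositionalEquality
open import Relation.Nullary using (¬_; does; yes; no; contradiction)
open import Algebra.Properties.Semiring.Sum +-*-semiring
  using (sum; sum-syntax; ∑-distrib-+; ∑-comm; *-distribˡ-sum; sum-cong-≗; sum-replicate-zero)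

m+o≡n⇒m≤n : ∀ {m n} o → m + o ≡ n → m ≤ n
m+o≡n⇒m≤n {m} o refl = m≤m+n m o

m+[1+o]≡n⇒m<n : ∀ {m n} o → m + suc o ≡ n → m < n
m+[1+o]≡n⇒m<n {m} o refl = m<m+n m z<s

sumFin≡sum : ∀ {n} (f : Fin n → ℕ) → sumFin f ≡ sum f
sumFin≡sum {zero}  f = refl
sumFin≡sum {suc n} f = cong (f zero +_) (sumFin≡sum (f ∘ suc))

sum-mono-≤ : ∀ {n} {f g : Fin n → ℕ} → (∀ i → f i ≤ g i) → sum f ≤ sum g
sum-mono-≤ {zero}  f≤g = z≤n
sum-mono-≤ {suc n} f≤g = +-mono-≤ (f≤g zero) (sum-mono-≤ (f≤g ∘ suc))

single : ∀ {n} → Fin n → ℕ → Fin n → ℕ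
single u c w = if does (w ≟ u) then c else 0

sum-single : ∀ {n} (u : Fin n) c → sum (single u c) ≡ c
sum-single {suc n} zero    c = trans (cong (c +_) (sum-replicate-zero n)) (+-identityʳ c)
sum-single         (suc u) c = sum-single u c

single-≤ : ∀ {n} (f : Fin n → ℕ) u w → single u (f u) w ≤ f w
single-≤ f u w with w ≟ u
... | yes refl = ≤-refl
... | no _     = z≤n

≤-sum : ∀ {n} (f : Fin n → ℕ) u → f u ≤ sum f
≤-sum f u = subst (_≤ sum f) (sum-single u (f u)) (sum-mono-≤ (single-≤ f u))

sum-+-single : ∀ {n} (f : Fin n → ℕ) u c → ∑[ w < n ] (f w + single u c w) ≡ sum f + c
sum-+-single f u c = trans (∑-distrib-+ f (single u c)) (cong (sum f +_) (sum-single u c))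

+-≤-sum : ∀ {n} (f : Fin n → ℕ) {u v} → u ≢ v → f u + f v ≤ sum f
+-≤-sum f {u} {v} u≢v = begin
  f u + f v                                         ≡⟨ cong₂ _+_ (sum-single u (f u)) (sum-single v (f v)) ⟨
  sum (single u (f u)) + sum (single v (f v))       ≡⟨ ∑-distrib-+ (single u (f u)) (single v (f v)) ⟨
  ∑[ w < _ ] (single u (f u) w + single v (f v) w)  ≤⟨ sum-mono-≤ pointwise ⟩
  sum f                                             ∎
  where
  open ≤-Reasoning
  pointwise : ∀ w → single u (f u) w + single v (f v) w ≤ f w
  pointwise w with w ≟ u | w ≟ v
  ... | yes refl | yes refl = contradiction refl u≢v
  ... | yes refl | no _     = ≤-reflexive (+-identityʳ (f w))
  ... | no _     | yes refl = ≤-refl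
  ... | no _     | no _     = z≤n

maximum-attained : ∀ {n} (f : Fin (suc n) → ℕ) → ∃ λ u → ∀ v → f v ≤ f u
maximum-attained f =
  argmax f zero (allFin _) , λ v → All.lookup (f[xs]≤f[argmax] {f = f} zero (allFin _)) (∈-allFin v)

falling₂ : ℕ → ℕ
falling₂ n = n * (n ∸ 1)

falling₂-suc : ∀ n → falling₂ (suc n) ≡ 2 * n + falling₂ n
falling₂-suc zero    = refl
falling₂-suc (suc n) = expand n
  where
  expand : ∀ n → (2 + n) * (1 + n) ≡ 2 * (1 + n) + (1 + n) * n
  expand = solve-∀

2*nC2≡falling₂ : ∀ n → 2 * (n C 2) ≡ falling₂ n
2*nC2≡falling₂ zero    = refl
2*nC2≡falling₂ (suc n) = begin
  2 * (suc n C 2)            ≡⟨ cong (2 *_) (nCk+nC[k+1]≡[n+1]C[k+1] n 1) ⟨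
  2 * (n C 1 + n C 2)        ≡⟨ *-distribˡ-+ 2 (n C 1) (n C 2) ⟩
  2 * (n C 1) + 2 * (n C 2)  ≡⟨ cong₂ _+_ (cong (2 *_) (nC1≡n n)) (2*nC2≡falling₂ n) ⟩
  2 * n + falling₂ n         ≡⟨ falling₂-suc n ⟨
  falling₂ (suc n)           ∎
  where open ≡-Reasoning

falling₂+n≡n*n : ∀ n → falling₂ n + n ≡ n * n
falling₂+n≡n*n zero    = refl
falling₂+n≡n*n (suc n) = expand n
  where
  expand : ∀ n → (1 + n) * n + (1 + n) ≡ (1 + n) * (1 + n)
  expand = solve-∀

falling₂-mono-≤ : ∀ {m n} → m ≤ n → falling₂ m ≤ falling₂ n
falling₂-mono-≤ m≤n = *-mono-≤ m≤n (∸-monoˡ-≤ 1 m≤n)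

falling₂[m]≤[n∸1]*m : ∀ {m n} → m ≤ n → falling₂ m ≤ (n ∸ 1) * m
falling₂[m]≤[n∸1]*m {m} {n} m≤n = subst (falling₂ m ≤_) (*-comm m (n ∸ 1)) (*-monoʳ-≤ m (∸-monoˡ-≤ 1 m≤n))

falling₂+m*b≤m*n : ∀ {n m b} → b ≤ 1 → b ≤ n → n ≤ m → falling₂ n + m * b ≤ m * n
falling₂+m*b≤m*n {n} {m} z≤n _ n≤m = begin
  falling₂ n + m * 0  ≡⟨ cong (falling₂ n +_) (*-zeroʳ m) ⟩
  falling₂ n + 0      ≡⟨ +-identityʳ (falling₂ n) ⟩
  n * (n ∸ 1)         ≤⟨ *-monoʳ-≤ n (m∸n≤m n 1) ⟩
  n * n               ≤⟨ *-monoˡ-≤ n n≤m ⟩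
  m * n               ∎
  where open ≤-Reasoning
falling₂+m*b≤m*n {suc n} {m} (s≤s z≤n) _ n≤m = begin
  suc n * n + m * 1   ≤⟨ +-mono-≤ (*-monoˡ-≤ n n≤m) (≤-reflexive (*-identityʳ m)) ⟩
  m * n + m           ≡⟨ +-comm (m * n) m ⟩
  m + m * n           ≡⟨ *-suc m n ⟨
  m * suc n           ∎
  where open ≤-Reasoning

<ᵇ≡true⇒< : ∀ {m n} → (m <ᵇ n) ≡ true → m < n
<ᵇ≡true⇒< {m} {n} m<ᵇn = <ᵇ⇒< m n (subst T (sym m<ᵇn) tt)

<ᵇ≡false⇒≥ : ∀ {m n} → (m <ᵇ n) ≡ false → n ≤ m
<ᵇ≡false⇒≥ m≮ᵇn = ≮⇒≥ (λ m<n → subst T m≮ᵇn (<⇒<ᵇ m<n))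

module GraphCounting {n : ℕ} (G : Graph n) where

  A : Fin n → Fin n → ℕ
  A i j = if adj G i j then 1 else 0

  d : Fin n → ℕ
  d = degree G

  A-sym : ∀ i j → A i j ≡ A j i
  A-sym i j = cong (λ b → if b then 1 else 0) (Graph.sym G i j)

  A-irrefl : ∀ i → A i i ≡ 0
  A-irrefl i rewrite Graph.irrefl G i = refl

  A≤1 : ∀ i j → A i j ≤ 1
  A≤1 i j with adj G i j
  ... | true  = ≤-refl
  ... | false = z≤n

  degree≡sum : ∀ v → d v ≡ ∑[ w < n ] A v w
  degree≡sum v = sumFin≡sum (A v)

  degree≡column-sum : ∀ v → d v ≡ ∑[ w < n ] A w v
  degree≡column-sum v = trans (degree≡sum v) (sum-cong-≗ (λ w → A-sym v w))

  A≤degree : ∀ i j → A i j ≤ d i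
  A≤degree i j = subst (A i j ≤_) (sym (degree≡sum i)) (≤-sum (A i) j)

  E : Fin n → Fin n → ℕ
  E i j = if adj G i j ∧ (toℕ i <ᵇ toℕ j) then 1 else 0

  A≡E+E : ∀ i j → A i j ≡ E i j + E j i
  A≡E+E i j rewrite Graph.sym G j i
    with adj G i j in adjᵢⱼ | toℕ i <ᵇ toℕ j in i<j | toℕ j <ᵇ toℕ i in j<i
  ... | false | _     | _     = refl
  ... | true  | true  | false = refl
  ... | true  | false | true  = refl
  ... | true  | true  | true  = contradiction (<ᵇ≡true⇒< {toℕ i} i<j) (<⇒≯ (<ᵇ≡true⇒< {toℕ j} j<i))
  ... | true  | false | false
    with toℕ-injective {i = i} {j = j} (≤-antisym (<ᵇ≡false⇒≥ {toℕ j} j<i) (<ᵇ≡false⇒≥ {toℕ i} i<j))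
  ...   | refl = contradiction (trans (sym adjᵢⱼ) (Graph.irrefl G i)) λ ()

  numEdges≡sum : numEdges G ≡ ∑[ i < n ] ∑[ j < n ] E i j
  numEdges≡sum = trans (sumFin≡sum (λ i → sumFin (E i))) (sum-cong-≗ (λ i → sumFin≡sum (E i)))

  handshake : ∑[ v < n ] d v ≡ 2 * numEdges G
  handshake = begin
    ∑[ v < n ] d v
      ≡⟨ sum-cong-≗ (λ v → trans (degree≡sum v) (sum-cong-≗ (A≡E+E v))) ⟩
    ∑[ v < n ] ∑[ w < n ] (E v w + E w v)
      ≡⟨ sum-cong-≗ (λ v → ∑-distrib-+ (E v) (λ w → E w v)) ⟩
    ∑[ v < n ] (∑[ w < n ] E v w + ∑[ w < n ] E w v)
      ≡⟨ ∑-distrib-+ (λ v → ∑[ w < n ] E v w) (λ v → ∑[ w < n ] E w v) ⟩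
    e + ∑[ v < n ] ∑[ w < n ] E w v
      ≡⟨ cong (e +_) (∑-comm (λ v w → E w v)) ⟩
    e + e
      ≡⟨ cong (e +_) (+-identityʳ e) ⟨
    2 * e
      ≡⟨ cong (2 *_) numEdges≡sum ⟨
    2 * numEdges G
      ∎
    where
    open ≡-Reasoning
    e = ∑[ i < n ] ∑[ j < n ] E i j

  -- The edges at u and at v are distinct, except possibly uv itself.
  degree+degree≤numEdges+1 : ∀ {u v} → u ≢ v → d u + d v ≤ numEdges G + 1
  degree+degree≤numEdges+1 {u} {v} u≢v = *-cancelˡ-≤ 2 (begin
    2 * (d u + d v)                                       ≡⟨ regroup (d u) (d v) ⟩
    d u + d v + d u + d v                                 ≡⟨ cong (λ s → s + d u + d v) column-sums ⟩
    ∑[ w < n ] (A w u + A w v) + d u + d v                ≡⟨ sum-+-single₂ (λ w → A w u + A w v) (d u) (d v) ⟨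
    ∑[ w < n ] (A w u + A w v + single u (d u) w + single v (d v) w)
                                                          ≤⟨ sum-mono-≤ pointwise ⟩
    ∑[ w < n ] (d w + single u 1 w + single v 1 w)        ≡⟨ sum-+-single₂ d 1 1 ⟩
    ∑[ w < n ] d w + 1 + 1                                ≡⟨ cong (λ s → s + 1 + 1) handshake ⟩
    2 * numEdges G + 1 + 1                                ≡⟨ regroup′ (numEdges G) ⟩
    2 * (numEdges G + 1)                                  ∎)
    where
    open ≤-Reasoning
    regroup : ∀ x y → 2 * (x + y) ≡ x + y + x + y
    regroup = solve-∀
    regroup′ : ∀ x → 2 * x + 1 + 1 ≡ 2 * (x + 1)
    regroup′ = solve-∀
    column-sums : d u + d v ≡ ∑[ w < n ] (A w u + A w v)
    column-sums = trans (cong₂ _+_ (degree≡column-sum u) (degree≡column-sum v))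
                        (sym (∑-distrib-+ (λ w → A w u) (λ w → A w v)))
    sum-+-single₂ : ∀ f a b → ∑[ w < n ] (f w + single u a w + single v b w) ≡ sum f + a + b
    sum-+-single₂ f a b = trans (sum-+-single (λ w → f w + single u a w) v b) (cong (_+ b) (sum-+-single f u a))
    pointwise : ∀ w →
      A w u + A w v + single u (d u) w + single v (d v) w ≤ d w + single u 1 w + single v 1 w
    pointwise w with w ≟ u | w ≟ v
    ... | yes refl | yes refl = contradiction refl u≢v
    ... | yes refl | no _     rewrite A-irrefl w | +-identityʳ (A w v + d w) | +-identityʳ (d w + 1) =
      ≤-trans (≤-reflexive (+-comm (A w v) (d w))) (+-monoʳ-≤ (d w) (A≤1 w v))
    ... | no _     | yes refl rewrite A-irrefl w | +-identityʳ (A w u) | +-identityʳ (A w u) | +-identityʳ (d w) =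
      ≤-trans (≤-reflexive (+-comm (A w u) (d w))) (+-monoʳ-≤ (d w) (A≤1 w u))
    ... | no _     | no _
      rewrite +-identityʳ (A w u + A w v) | +-identityʳ (A w u + A w v) | +-identityʳ (d w) | +-identityʳ (d w) =
      subst (A w u + A w v ≤_) (sym (degree≡sum w)) (+-≤-sum (A w) u≢v)

  2*lineGraphEdges≡sum : 2 * lineGraphEdges G ≡ ∑[ v < n ] falling₂ (d v)
  2*lineGraphEdges≡sum = begin
    2 * lineGraphEdges G            ≡⟨ cong (2 *_) (sumFin≡sum (λ v → d v C 2)) ⟩
    2 * ∑[ v < n ] (d v C 2)        ≡⟨ *-distribˡ-sum 2 (λ v → d v C 2) ⟩
    ∑[ v < n ] (2 * (d v C 2))      ≡⟨ sum-cong-≗ (λ v → 2*nC2≡falling₂ (d v)) ⟩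
    ∑[ v < n ] falling₂ (d v)       ∎
    where open ≡-Reasoning

  falling₂-degree≤ : ∀ u → falling₂ (d u) ≤ 2 * lineGraphEdges G
  falling₂-degree≤ u = subst (falling₂ (d u) ≤_) (sym 2*lineGraphEdges≡sum) (≤-sum (falling₂ ∘ d) u)

  2*lineGraphEdges≤maxDegree : ∀ Δ → (∀ v → d v ≤ Δ) → 2 * lineGraphEdges G ≤ (Δ ∸ 1) * (2 * numEdges G)
  2*lineGraphEdges≤maxDegree Δ d≤Δ = begin
    2 * lineGraphEdges G            ≡⟨ 2*lineGraphEdges≡sum ⟩
    ∑[ v < n ] falling₂ (d v)       ≤⟨ sum-mono-≤ (λ v → falling₂[m]≤[n∸1]*m (d≤Δ v)) ⟩
    ∑[ v < n ] ((Δ ∸ 1) * d v)      ≡⟨ *-distribˡ-sum (Δ ∸ 1) d ⟨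
    (Δ ∸ 1) * ∑[ v < n ] d v        ≡⟨ cong ((Δ ∸ 1) *_) handshake ⟩
    (Δ ∸ 1) * (2 * numEdges G)      ∎
    where open ≤-Reasoning

  -- Every v ≠ u has d v ≤ m by degree+degree≤numEdges+1, so a neighbour of u contributes
  -- d v (d v − 1) ≤ m (d v − 1) and any other vertex at most m d v.
  2*lineGraphEdges≤star : ∀ u m → d u + m ≡ numEdges G + 1 →
    2 * lineGraphEdges G + m * (d u + d u) ≤ falling₂ (d u) + m * (2 * numEdges G)
  2*lineGraphEdges≤star u m du+m≡e+1 = begin
    2 * lineGraphEdges G + m * (d u + d u)
      ≡⟨ regroup (2 * lineGraphEdges G) m (d u) ⟩
    2 * lineGraphEdges G + m * d u + m * d u
      ≡⟨ cong (_+ m * d u) (cong₂ _+_ 2*lineGraphEdges≡sum m*degree≡sum) ⟩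
    ∑[ v < n ] falling₂ (d v) + ∑[ v < n ] (m * A u v) + m * d u
      ≡⟨ cong (_+ m * d u) (∑-distrib-+ (falling₂ ∘ d) (λ v → m * A u v)) ⟨
    ∑[ v < n ] (falling₂ (d v) + m * A u v) + m * d u
      ≡⟨ sum-+-single (λ v → falling₂ (d v) + m * A u v) u (m * d u) ⟨
    ∑[ v < n ] (falling₂ (d v) + m * A u v + single u (m * d u) v)
      ≤⟨ sum-mono-≤ pointwise ⟩
    ∑[ v < n ] (m * d v + single u (falling₂ (d u)) v)
      ≡⟨ sum-+-single (λ v → m * d v) u (falling₂ (d u)) ⟩
    ∑[ v < n ] (m * d v) + falling₂ (d u)
      ≡⟨ cong (_+ falling₂ (d u)) (*-distribˡ-sum m d) ⟨
    m * ∑[ v < n ] d v + falling₂ (d u)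
      ≡⟨ cong (λ s → m * s + falling₂ (d u)) handshake ⟩
    m * (2 * numEdges G) + falling₂ (d u)
      ≡⟨ +-comm (m * (2 * numEdges G)) (falling₂ (d u)) ⟩
    falling₂ (d u) + m * (2 * numEdges G)
      ∎
    where
    open ≤-Reasoning
    regroup : ∀ x m y → x + m * (y + y) ≡ x + m * y + m * y
    regroup = solve-∀
    m*degree≡sum : m * d u ≡ ∑[ v < n ] (m * A u v)
    m*degree≡sum = trans (cong (m *_) (degree≡sum u)) (*-distribˡ-sum m (A u))
    d≤m : ∀ {v} → u ≢ v → d v ≤ m
    d≤m {v} u≢v = +-cancelˡ-≤ (d u) (d v) m (subst (d u + d v ≤_) (sym du+m≡e+1) (degree+degree≤numEdges+1 u≢v))
    pointwise : ∀ v →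
      falling₂ (d v) + m * A u v + single u (m * d u) v ≤ m * d v + single u (falling₂ (d u)) v
    pointwise v with v ≟ u
    ... | yes refl rewrite A-irrefl v | *-zeroʳ m | +-identityʳ (falling₂ (d v)) =
      ≤-reflexive (+-comm (falling₂ (d v)) (m * d v))
    ... | no v≢u rewrite +-identityʳ (falling₂ (d v) + m * A u v) | +-identityʳ (m * d v) =
      falling₂+m*b≤m*n (A≤1 u v) (subst (_≤ d v) (A-sym v u) (A≤degree v u)) (d≤m (v≢u ∘ sym))

gapValue : ℕ → ℕ → ℕ
gapValue n K = n C 2 + (K * K + K + 1)

2*gapValue-unfold : ∀ n K → 2 * gapValue n K ≡ falling₂ n + 2 * (K * K + K + 1)
2*gapValue-unfold n K = trans (*-distribˡ-+ 2 (n C 2) _) (cong (_+ 2 * (K * K + K + 1)) (2*nC2≡falling₂ n))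

2*gapValue+n-unfold : ∀ n K → 2 * gapValue n K + n ≡ n * n + 2 * (K * K + K + 1)
2*gapValue+n-unfold n K = begin
  2 * gapValue n K + n                       ≡⟨ cong (_+ n) (2*gapValue-unfold n K) ⟩
  falling₂ n + 2 * (K * K + K + 1) + n       ≡⟨ shuffle (falling₂ n) (2 * (K * K + K + 1)) n ⟩
  falling₂ n + n + 2 * (K * K + K + 1)       ≡⟨ cong (_+ 2 * (K * K + K + 1)) (falling₂+n≡n*n n) ⟩
  n * n + 2 * (K * K + K + 1)                ∎
  where
  open ≡-Reasoning
  shuffle : ∀ a b c → a + b + c ≡ a + c + b
  shuffle = solve-∀

2*gapValue<falling₂ : ∀ {n Δ} K → K * K + K + 2 ≤ n → n < Δ → 2 * gapValue n K < falling₂ Δ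
2*gapValue<falling₂ {n} {Δ} K n-large n<Δ = begin-strict
  2 * gapValue n K                    ≡⟨ 2*gapValue-unfold n K ⟩
  falling₂ n + 2 * (K * K + K + 1)    <⟨ +-monoʳ-< (falling₂ n) (*-monoʳ-< 2 c<n) ⟩
  falling₂ n + 2 * n                  ≡⟨ trans (+-comm (falling₂ n) (2 * n)) (sym (falling₂-suc n)) ⟩
  falling₂ (suc n)                    ≤⟨ falling₂-mono-≤ n<Δ ⟩
  falling₂ Δ                          ∎
  where
  open ≤-Reasoning
  c<n : K * K + K + 1 < n
  c<n = subst (_≤ n) (+-suc (K * K + K) 1) n-large

-- Writing n = Δ + t, the star bound falls short of 2 × gapValue by t (2Δ − 4K − t − 3) + 2.
star<2*gapValue : ∀ Δ t K → 4 * K + t + 3 ≤ 2 * Δ →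
  falling₂ Δ + (K + t + 1) * (2 * (Δ + t + K)) < 2 * gapValue (Δ + t) K + (K + t + 1) * (Δ + Δ)
star<2*gapValue zero    t K 4K+t+3≤0 = contradiction (≤-trans (m≤n+m 3 (4 * K + t)) 4K+t+3≤0) λ ()
star<2*gapValue (suc δ) t K 4K+t+3≤2Δ = begin-strict
  star                  <⟨ m<m+n star z<s ⟩
  star + 2              ≤⟨ +-cancelʳ-≤ (t * (4 * K + t + 3)) (star + 2) target (begin
    star + 2 + t * (4 * K + t + 3)   ≤⟨ +-monoʳ-≤ (star + 2) (*-monoʳ-≤ t 4K+t+3≤2Δ) ⟩
    star + 2 + t * (2 * suc δ)       ≡⟨ expand δ t K ⟩
    target′ + t * (4 * K + t + 3)    ≡⟨ cong (λ x → x + (K + t + 1) * (suc δ + suc δ) + t * (4 * K + t + 3))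
                                              (2*gapValue-unfold (suc δ + t) K) ⟨
    target + t * (4 * K + t + 3)     ∎) ⟩
  target                ∎
  where
  open ≤-Reasoning
  star = falling₂ (suc δ) + (K + t + 1) * (2 * (suc δ + t + K))
  target = 2 * gapValue (suc δ + t) K + (K + t + 1) * (suc δ + suc δ)
  target′ = falling₂ (suc δ + t) + 2 * (K * K + K + 1) + (K + t + 1) * (suc δ + suc δ)
  expand : ∀ δ t K →
    (1 + δ) * δ + (K + t + 1) * (2 * (1 + δ + t + K)) + 2 + t * (2 * (1 + δ))
      ≡ (1 + δ + t) * (δ + t) + 2 * (K * K + K + 1) + (K + t + 1) * ((1 + δ) + (1 + δ)) + t * (4 * K + t + 3)
  expand = solve-∀

quadratic-excess : ∀ {n} K → K * K + 11 * K + 2 ≤ n →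
  (n + 4 * K) * (2 * (n + K)) + 3 * n < 3 * (n * n + 2 * (K * K + K + 1)) + 2 * (n + K)
quadratic-excess K n-large with m≤n⇒∃[o]m+o≡n n-large
... | s , base+s≡n = subst (λ n → (n + 4 * K) * (2 * (n + K)) + 3 * n < 3 * (n * n + 2 * (K * K + K + 1)) + 2 * (n + K))
                           base+s≡n (m+[1+o]≡n⇒m<n _ (expand K s))
  where
  expand : ∀ K s → let n = K * K + 11 * K + 2 + s in
    (n + 4 * K) * (2 * (n + K)) + 3 * n
      + suc (7 + 21 * K + 12 * K * s + 12 * (K * K) + 2 * (K * K) * s + 12 * (K * K * K)
             + K * K * K * K + 3 * s + s * s)
      ≡ 3 * (n * n + 2 * (K * K + K + 1)) + 2 * (n + K)
  expand = solve-∀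

0<2*gapValue : ∀ n K → 0 < 2 * gapValue n K
0<2*gapValue n K = <-≤-trans (s≤s z≤n) (begin
  1                            ≤⟨ m≤n+m 1 (K * K + K) ⟩
  K * K + K + 1                ≤⟨ m≤n+m (K * K + K + 1) (n C 2) ⟩
  gapValue n K                 ≤⟨ m≤m+n (gapValue n K) (gapValue n K + 0) ⟩
  2 * gapValue n K             ∎)
  where open ≤-Reasoning

maxDegree<2*gapValue : ∀ {n Δ} K → K * K + 11 * K + 2 ≤ n → 3 * Δ ≤ n + 4 * K + 2 →
  (Δ ∸ 1) * (2 * (n + K)) < 2 * gapValue n K
maxDegree<2*gapValue {n} {zero}  K _       _           = 0<2*gapValue n K
maxDegree<2*gapValue {n} {suc δ} K n-large 3Δ≤n+4K+2 =
  *-cancelˡ-< 3 (δ * (2 * e)) (2 * gapValue n K)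
    (+-cancelʳ-< (2 * e) (3 * (δ * (2 * e))) (3 * (2 * gapValue n K)) (begin-strict
      3 * (δ * (2 * e)) + 2 * e       ≡⟨ distrib δ (2 * e) ⟩
      (3 * δ + 1) * (2 * e)           ≤⟨ *-monoˡ-≤ (2 * e) 3δ+1≤n+4K ⟩
      (n + 4 * K) * (2 * e)           <⟨ excess ⟩
      3 * (2 * gapValue n K) + 2 * e  ∎))
  where
  open ≤-Reasoning
  e = n + K
  3δ+1≤n+4K : 3 * δ + 1 ≤ n + 4 * K
  3δ+1≤n+4K = +-cancelʳ-≤ 2 (3 * δ + 1) (n + 4 * K) (subst (_≤ n + 4 * K + 2) (3*suc δ) 3Δ≤n+4K+2)
    where
    3*suc : ∀ δ → 3 * suc δ ≡ 3 * δ + 1 + 2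
    3*suc = solve-∀
  distrib : ∀ x y → 3 * (x * y) + y ≡ (3 * x + 1) * y
  distrib = solve-∀
  excess : (n + 4 * K) * (2 * e) < 3 * (2 * gapValue n K) + 2 * e
  excess = +-cancelʳ-< (3 * n) ((n + 4 * K) * (2 * e)) (3 * (2 * gapValue n K) + 2 * e) (begin-strict
    (n + 4 * K) * (2 * e) + 3 * n              <⟨ quadratic-excess K n-large ⟩
    3 * (n * n + 2 * (K * K + K + 1)) + 2 * e  ≡⟨ cong (λ x → 3 * x + 2 * e) (2*gapValue+n-unfold n K) ⟨
    3 * (2 * gapValue n K + n) + 2 * e         ≡⟨ regroup (2 * gapValue n K) n (2 * e) ⟩
    3 * (2 * gapValue n K) + 2 * e + 3 * n     ∎)
    where
    regroup : ∀ x y z → 3 * (x + y) + z ≡ 3 * x + z + 3 * y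
    regroup = solve-∀

-- The bounds on X = 2 e(L(G)) for a graph G with e edges and maximum degree Δ.
DegreeBounds : ℕ → ℕ → ℕ → Set
DegreeBounds Δ e X = falling₂ Δ ≤ X × X ≤ (Δ ∸ 1) * (2 * e)
  × (∀ m → Δ + m ≡ e + 1 → X + m * (Δ + Δ) ≤ falling₂ Δ + m * (2 * e))

2*gapValue-excluded-below : ∀ Δ t K → K * K + 11 * K + 2 ≤ Δ + t →
  ¬ DegreeBounds Δ (Δ + t + K) (2 * gapValue (Δ + t) K)
2*gapValue-excluded-below Δ t K n-large (_ , high , star) with 3 * Δ ≤? Δ + t + 4 * K + 2
... | yes 3Δ≤n+4K+2 = <⇒≱ (maxDegree<2*gapValue {Δ = Δ} K n-large 3Δ≤n+4K+2) high
... | no  3Δ≰n+4K+2 = <⇒≱ (star<2*gapValue Δ t K 4K+t+3≤2Δ) (star (K + t + 1) (regroup Δ t K))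
  where
  4K+t+3≤2Δ : 4 * K + t + 3 ≤ 2 * Δ
  4K+t+3≤2Δ = +-cancelˡ-≤ Δ (4 * K + t + 3) (2 * Δ)
    (subst₂ _≤_ (regroupˡ Δ t K) (regroupʳ Δ) (≰⇒> 3Δ≰n+4K+2))
    where
    regroupˡ : ∀ Δ t K → suc (Δ + t + 4 * K + 2) ≡ Δ + (4 * K + t + 3)
    regroupˡ = solve-∀
    regroupʳ : ∀ Δ → 3 * Δ ≡ Δ + 2 * Δ
    regroupʳ = solve-∀
  regroup : ∀ Δ t K → Δ + (K + t + 1) ≡ Δ + t + K + 1
  regroup = solve-∀

2*gapValue-excluded : ∀ Δ n K → K * K + 11 * K + 2 ≤ n → ¬ DegreeBounds Δ (n + K) (2 * gapValue n K)
2*gapValue-excluded Δ n K n-large bounds@(low , _) with n <? Δ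
... | yes n<Δ =
  <⇒≱ (2*gapValue<falling₂ K (≤-trans (+-monoˡ-≤ 2 (+-monoʳ-≤ (K * K) (m≤n*m K 11))) n-large) n<Δ) low
... | no  n≮Δ with m≤n⇒∃[o]m+o≡n (≮⇒≥ n≮Δ)
...   | t , refl = 2*gapValue-excluded-below Δ t K n-large bounds

degreeBounds : ∀ {v} (G : Graph (suc v)) → ∃ λ Δ → DegreeBounds Δ (numEdges G) (2 * lineGraphEdges G)
degreeBounds G =
  degree G u , falling₂-degree≤ u , 2*lineGraphEdges≤maxDegree (degree G u) maximal , 2*lineGraphEdges≤star u
  where
  open GraphCounting G
  u = proj₁ (maximum-attained (degree G))
  maximal = proj₂ (maximum-attained (degree G))

gapValue-unrealisable : ∀ {v} K n → K * K + 11 * K + 2 ≤ n → (G : Graph v) →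
  numEdges G ≡ n + K → lineGraphEdges G ≢ gapValue n K
gapValue-unrealisable {zero}  K n n-large G 0≡n+K _ =
  contradiction (subst (2 ≤_) (sym 0≡n+K) (≤-trans (≤-trans (m≤n+m 2 _) n-large) (m≤m+n n K))) λ ()
gapValue-unrealisable {suc v} K n n-large G e≡n+K L≡M =
  2*gapValue-excluded Δ n K n-large (subst₂ (DegreeBounds Δ) e≡n+K (cong (2 *_) L≡M) bounds)
  where
  Δ = proj₁ (degreeBounds G)
  bounds = proj₂ (degreeBounds G)

2KN+2*gapValue≤N² : ∀ K {n} → 3 * (K * K) + 2 * K + 2 ≤ n →
  2 * K * (K + n) + 2 * gapValue n K ≤ (K + n) ^ 2
2KN+2*gapValue≤N² K {n} n-large =
  +-cancelʳ-≤ n (2 * K * (K + n) + 2 * gapValue n K) ((K + n) ^ 2) (begin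
  2 * K * (K + n) + 2 * gapValue n K + n             ≡⟨ +-assoc (2 * K * (K + n)) (2 * gapValue n K) n ⟩
  2 * K * (K + n) + (2 * gapValue n K + n)           ≡⟨ cong (2 * K * (K + n) +_) (2*gapValue+n-unfold n K) ⟩
  2 * K * (K + n) + (n * n + 2 * (K * K + K + 1))    ≤⟨ slack n-large ⟩
  (K + n) * (K + n) + n                              ≡⟨ cong (λ x → (K + n) * x + n) (*-identityʳ (K + n)) ⟨
  (K + n) ^ 2 + n                                    ∎)
  where
  open ≤-Reasoning
  slack : ∀ {n} → 3 * (K * K) + 2 * K + 2 ≤ n →
    2 * K * (K + n) + (n * n + 2 * (K * K + K + 1)) ≤ (K + n) * (K + n) + n
  slack n-large with m≤n⇒∃[o]m+o≡n n-large
  ... | s , base+s≡n = subst (λ n → 2 * K * (K + n) + (n * n + 2 * (K * K + K + 1)) ≤ (K + n) * (K + n) + n)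
                             base+s≡n (m+o≡n⇒m≤n s (expand K s))
    where
    expand : ∀ K s → let n = 3 * (K * K) + 2 * K + 2 + s in
      2 * K * (K + n) + (n * n + 2 * (K * K + K + 1)) + s ≡ (K + n) * (K + n) + n
    expand = solve-∀

2KN+2M≤N²⇒M≤NC2 : ∀ K {N M} .{{_ : NonZero K}} → 2 * K * N + 2 * M ≤ N ^ 2 → M ≤ N C 2
2KN+2M≤N²⇒M≤NC2 K {N} {M} slack =
  *-cancelˡ-≤ 2 (subst (2 * M ≤_) (sym (2*nC2≡falling₂ N)) (+-cancelʳ-≤ N (2 * M) (falling₂ N) (begin
  2 * M + N                       ≤⟨ +-monoʳ-≤ (2 * M) (m≤n*m N (2 * K) {{m*n≢0 2 K}}) ⟩
  2 * M + 2 * K * N               ≡⟨ +-comm (2 * M) (2 * K * N) ⟩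
  2 * K * N + 2 * M               ≤⟨ slack ⟩
  N * (N * 1)                     ≡⟨ cong (N *_) (*-identityʳ N) ⟩
  N * N                           ≡⟨ falling₂+n≡n*n N ⟨
  falling₂ N + N                  ∎)))
  where open ≤-Reasoning

4N³≤64X² : ∀ {K N X} → N ≤ 64 * (K * K) → 2 * K * N ≤ X → 4 * (N ^ 3) ≤ 64 * (X ^ 2)
4N³≤64X² {K} {N} {X} N≤64K² 2KN≤X = begin
  4 * (N ^ 3)                     ≡⟨ cube N ⟩
  4 * N * (N * N)                 ≤⟨ *-monoˡ-≤ (N * N) (*-monoʳ-≤ 4 N≤64K²) ⟩
  4 * (64 * (K * K)) * (N * N)    ≡⟨ square K N ⟩
  64 * ((2 * K * N) ^ 2)          ≤⟨ *-monoʳ-≤ 64 (^-monoˡ-≤ 2 2KN≤X) ⟩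
  64 * (X ^ 2)                    ∎
  where
  open ≤-Reasoning
  cube : ∀ N → 4 * (N * (N * (N * 1))) ≡ 4 * N * (N * N)
  cube = solve-∀
  square : ∀ K N → 4 * (64 * (K * K)) * (N * N) ≡ 64 * (2 * K * N * (2 * K * N * 1))
  square = solve-∀

16K²≤K+n⇒15K²≤n : ∀ K n .{{_ : NonZero K}} → 16 * (K * K) ≤ K + n → 15 * (K * K) ≤ n
16K²≤K+n⇒15K²≤n K n 16K²≤K+n = +-cancelˡ-≤ K (15 * (K * K)) n (begin
  K + 15 * (K * K)                ≤⟨ +-monoˡ-≤ (15 * (K * K)) (m≤m*n K K) ⟩
  K * K + 15 * (K * K)            ≡⟨ regroup (K * K) ⟩
  16 * (K * K)                    ≤⟨ 16K²≤K+n ⟩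
  K + n                           ∎)
  where
  open ≤-Reasoning
  regroup : ∀ x → x + 15 * x ≡ 16 * x
  regroup = solve-∀

K²+11K+2≤15K² : ∀ k → let K = suc k in K * K + 11 * K + 2 ≤ 15 * (K * K)
K²+11K+2≤15K² k = m+o≡n⇒m≤n (14 * (k * k) + 17 * k + 1) (expand k)
  where
  expand : ∀ k → let K = suc k in K * K + 11 * K + 2 + (14 * (k * k) + 17 * k + 1) ≡ 15 * (K * K)
  expand = solve-∀

3K²+2K+2≤15K² : ∀ k → let K = suc k in 3 * (K * K) + 2 * K + 2 ≤ 15 * (K * K)
3K²+2K+2≤15K² k = m+o≡n⇒m≤n (12 * (k * k) + 22 * k + 8) (expand k)
  where
  expand : ∀ k → let K = suc k in 3 * (K * K) + 2 * K + 2 + (12 * (k * k) + 22 * k + 8) ≡ 15 * (K * K)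
  expand = solve-∀

N<16[K+1]²⇒N≤64K² : ∀ K {N} .{{_ : NonZero K}} → N < 16 * (suc K * suc K) → N ≤ 64 * (K * K)
N<16[K+1]²⇒N≤64K² K {N} N<16[K+1]² = begin
  N                               ≤⟨ <⇒≤ N<16[K+1]² ⟩
  16 * (suc K * suc K)            ≤⟨ *-monoʳ-≤ 16 (*-mono-≤ 1+K≤2K 1+K≤2K) ⟩
  16 * (2 * K * (2 * K))          ≡⟨ regroup K ⟩
  64 * (K * K)                    ∎
  where
  open ≤-Reasoning
  1+K≤2K : suc K ≤ 2 * K
  1+K≤2K = subst (_≤ 2 * K) (+-comm K 1) (+-monoʳ-≤ K (≤-trans (>-nonZero⁻¹ K) (m≤m+n K 0)))
  regroup : ∀ K → 16 * (2 * K * (2 * K)) ≡ 64 * (K * K)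
  regroup = solve-∀

squares-bracket : ∀ c .{{_ : NonZero c}} N → ∃ λ k → c * (k * k) ≤ N × N < c * (suc k * suc k)
squares-bracket c zero = 0 , ≤-reflexive (*-zeroʳ c) , subst (0 <_) (sym (*-identityʳ c)) (>-nonZero⁻¹ c)
squares-bracket c (suc N) with squares-bracket c N
... | k , lo , hi with m≤n⇒m<n∨m≡n hi
...   | inj₁ 1+N<  = k , m≤n⇒m≤1+n lo , 1+N<
...   | inj₂ 1+N≡ = suc k , ≤-reflexive (sym 1+N≡) ,
  subst (_< c * (suc (suc k) * suc (suc k))) (sym 1+N≡) (*-monoʳ-< c (*-mono-< (n<1+n (suc k)) (n<1+n (suc k))))

MissedValue : ℕ → ℕ → ℕ → ℕ → Set
MissedValue p q N M = M ≤ N C 2 × ¬ Realisable N M × 2 * M ≤ N ^ 2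
  × 4 * (p ^ 2) * (N ^ 3) ≤ (q ^ 2) * ((N ^ 2 ∸ 2 * M) ^ 2)

gapValue-missed : ∀ k n {N} → suc k + n ≡ N →
  16 * (suc k * suc k) ≤ N → N < 16 * (suc (suc k) * suc (suc k)) → MissedValue 1 8 N (gapValue n (suc k))
gapValue-missed k n refl 16K²≤N N<16[K+1]² =
  2KN+2M≤N²⇒M≤NC2 K {N} {M} slack , unrealisable , ≤-trans (m≤n+m (2 * M) (2 * K * N)) slack ,
  4N³≤64X² {K} {N} (N<16[K+1]²⇒N≤64K² K N<16[K+1]²) (m+n≤o⇒m≤o∸n (2 * K * N) slack)
  where
  K = suc k
  N = K + n
  M = gapValue n K
  15K²≤n : 15 * (K * K) ≤ n
  15K²≤n = 16K²≤K+n⇒15K²≤n K n 16K²≤N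
  slack : 2 * K * N + 2 * M ≤ N ^ 2
  slack = 2KN+2*gapValue≤N² K {n} (≤-trans (3K²+2K+2≤15K² k) 15K²≤n)
  unrealisable : ¬ Realisable N M
  unrealisable (_ , F , _ , e≡N , L≡M) =
    gapValue-unrealisable K n (≤-trans (K²+11K+2≤15K² k) 15K²≤n) F (trans e≡N (+-comm K n)) L≡M

mainTheorem9 : ∃ λ (p : ℕ) → ∃ λ (q : ℕ) → 0 < p × 0 < q ×
    (∃ λ (N₀ : ℕ) → ∀ (N : ℕ) → N₀ ≤ N →
      ∃ λ (M : ℕ) → M ≤ N C 2 × ¬ Realisable N M ×
        (2 * M ≤ N ^ 2) ×
        (4 * (p ^ 2) * (N ^ 3) ≤ (q ^ 2) * ((N ^ 2 ∸ 2 * M) ^ 2)))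
mainTheorem9 = 1 , 8 , s≤s z≤n , s≤s z≤n , 16 , missed
  where
  missed : ∀ N → 16 ≤ N → ∃ (MissedValue 1 8 N)
  missed N 16≤N with squares-bracket 16 N
  ... | zero  , _ , N<16 = contradiction 16≤N (<⇒≱ N<16)
  ... | suc k , 16K²≤N , N<16[K+1]² =
    let K≤N = ≤-trans (≤-trans (m≤m*n (suc k) (suc k)) (m≤n*m (suc k * suc k) 16)) 16K²≤N
        n , K+n≡N = m≤n⇒∃[o]m+o≡n K≤N
    in gapValue n (suc k) , gapValue-missed k n K+n≡N 16K²≤N N<16[K+1]²
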